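{- For any type $X$, the map $q:\mathcal L_{\mathrm{RS}}(X)\to\mathcal L_{\operatorname{isRosolini}}(X)$, $q(P,d,\varphi):=(P,|d|,\varphi)$, is surjective. Moreover, when $X$ is a set, there is an equivalence $E:\mathcal L_{\operatorname{isRosolini}}(X)\simeq\mathsf D(X)/{\approx}$ compatible with the quotient map, namely $E(P_\delta,-,v_\delta)=[\delta]$ for every $\delta:\mathsf D(X)$, where $P_\delta:=\sum_{n:\mathbb N}\sum_{x:X}\delta(n)=\mathrm{inl}(x)$ and $v_\delta(n,x,p):=x$.
   Context: Type theory: Martin-Löf type theory with universe $\mathcal U$, function extensionality, proposition extensionality, propositional truncations and set quotients. For $\alpha:\mathbb N\to2$, $\langle\alpha\rangle:=\sum_n(\alpha_n=1)$; $\mathbb N_\infty:=\sum_\alpha\operatorname{isProp}\langle\alpha\rangle$; $\operatorname{rosoliniStructure}(P):=\sum_{u:\mathbb N_\infty}(P=\langle u\rangle)$; $\operatorname{isRosolini}(P):=\lVert\operatorname{rosoliniStructure}(P)\rVert$. $\mathcal L_{\mathrm{RS}}(X):=\sum_{P:\mathcal U}\operatorname{rosoliniStructure}(P)\times(P\to X)$ and $\mathcal L_{\operatorname{isRosolini}}(X):=\sum_{P:\mathcal U}\operatorname{isRosolini}(P)\times(P\to X)$. The delay type is $\mathsf D(X):=\sum_{\delta:\mathbb N\to X+1}\operatorname{isProp}\big(\sum_{n}\sum_{x:X}\delta(n)=\mathrm{inl}(x)\big)$ (sequences with at most one defined entry). Convergence: $\delta\downarrow x:=\sum_n\delta(n)=\mathrm{inl}(x)$;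 weak bisimilarity: $\delta_1\approx\delta_2:=\prod_{x:X}\big((\delta_1\downarrow x)\leftrightarrow(\delta_2\downarrow x)\big)$; $\mathsf D(X)/{\approx}$ is the set quotient with quotient map $[-]$. -}

module Defs where

open import Level using (Level; _⊔_; Setω) renaming (suc to lsuc)
open import Data.Nat using (ℕ)
open import Data.Bool using (Bool; true)
open import Data.Unit using (⊤)
open import Data.Sum using (_⊎_; inj₁; inj₂)
open import Data.Product using (Σ; _×_; _,_; proj₁; proj₂)
open import Relation.Binary.PropositionalEquality using (_≡_)

isProp : ∀ {ℓ} → Set ℓ → Set ℓ
isProp A = (x y : A) → x ≡ y

isSet : ∀ {ℓ} → Set ℓ → Set ℓ
isSet A = (x y : A) → isProp (x ≡ y)

isEquiv : ∀ {a b} {A : Set a} {B : Set b} → (A → B) → Set (a ⊔ b)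
isEquiv {A = A} {B} f =
  (Σ (B → A) λ g → ∀ x → g (f x) ≡ x) × (Σ (B → A) λ h → ∀ y → f (h y) ≡ y)

FunExt : Setω
FunExt = ∀ {a b} {A : Set a} {B : A → Set b} {f g : (x : A) → B x}
       → (∀ x → f x ≡ g x) → f ≡ g

PropExt : Set₁
PropExt = (P Q : Set) → isProp P → isProp Q → (P → Q) → (Q → P) → P ≡ Q

record PropTrunc : Setω where
  field
    ∥_∥ : ∀ {ℓ} → Set ℓ → Set ℓ
    ∣_∣ : ∀ {ℓ} {A : Set ℓ} → A → ∥ A ∥
    ∥∥-isProp : ∀ {ℓ} {A : Set ℓ} → isProp ∥ A ∥
    ∥∥-rec : ∀ {ℓ ℓ'} {A : Set ℓ} {B : Set ℓ'} → isProp B → (A → B) → ∥ A ∥ → B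

record SetQuot : Setω where
  field
    _/_ : ∀ {ℓ ℓ'} (A : Set ℓ) → (A → A → Set ℓ') → Set (ℓ ⊔ ℓ')
    [_] : ∀ {ℓ ℓ'} {A : Set ℓ} {R : A → A → Set ℓ'} → A → A / R
    /-identify : ∀ {ℓ ℓ'} {A : Set ℓ} {R : A → A → Set ℓ'} {a b : A}
               → R a b → [_] {R = R} a ≡ [ b ]
    /-isSet : ∀ {ℓ ℓ'} {A : Set ℓ} {R : A → A → Set ℓ'} → isSet (A / R)
    /-rec : ∀ {ℓ ℓ' ℓ''} {A : Set ℓ} {R : A → A → Set ℓ'} {B : Set ℓ''}
          → isSet B → (f : A → B) → (∀ a b → R a b → f a ≡ f b) → A / R → B
    /-rec-β : ∀ {ℓ ℓ' ℓ''} {A : Set ℓ} {R : A → A → Set ℓ'} {B : Set ℓ''}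
            (s : isSet B) (f : A → B) (r : ∀ a b → R a b → f a ≡ f b) (a : A)
            → /-rec {R = R} s f r [ a ] ≡ f a
    /-ind-prop : ∀ {ℓ ℓ' ℓ''} {A : Set ℓ} {R : A → A → Set ℓ'} {P : A / R → Set ℓ''}
               → (∀ x → isProp (P x)) → (∀ a → P [ a ]) → ∀ x → P x

-- 𝟚 is Bool with 1 = true
⟨_⟩ : (ℕ → Bool) → Set
⟨ α ⟩ = Σ ℕ λ n → α n ≡ true

ℕ∞ : Set
ℕ∞ = Σ (ℕ → Bool) λ α → isProp ⟨ α ⟩

rosoliniStructure : Set → Set₁
rosoliniStructure P = Σ ℕ∞ λ u → P ≡ ⟨ proj₁ u ⟩

𝓛-RS : Set → Set₁
𝓛-RS X = Σ Set λ P → rosoliniStructure P × (P → X)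

-- Delay type: sequences with at most one defined entry
_↓-seq_ : {X : Set} → (ℕ → X ⊎ ⊤) → X → Set
δ ↓-seq x = Σ ℕ λ n → δ n ≡ inj₁ x

Defined : {X : Set} → (ℕ → X ⊎ ⊤) → Set
Defined {X} δ = Σ ℕ λ n → Σ X λ x → δ n ≡ inj₁ x

𝓓 : Set → Set
𝓓 X = Σ (ℕ → X ⊎ ⊤) λ δ → isProp (Defined δ)

_↓_ : {X : Set} → 𝓓 X → X → Set
d ↓ x = proj₁ d ↓-seq x

_≈_ : {X : Set} → 𝓓 X → 𝓓 X → Set
_≈_ {X} d₁ d₂ = (x : X) → ((d₁ ↓ x) → (d₂ ↓ x)) × ((d₂ ↓ x) → (d₁ ↓ x))

P[_] : {X : Set} → 𝓓 X → Set
P[ d ] = Defined (proj₁ d)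

v[_] : {X : Set} (d : 𝓓 X) → P[ d ] → X
v[ d ] (n , x , p) = x

module WithPT (pt : PropTrunc) where
  open PropTrunc pt

  isRosolini : Set → Set₁
  isRosolini P = ∥ rosoliniStructure P ∥

  𝓛-isRosolini : Set → Set₁
  𝓛-isRosolini X = Σ Set λ P → isRosolini P × (P → X)

  q : {X : Set} → 𝓛-RS X → 𝓛-isRosolini X
  q (P , d , φ) = P , ∣ d ∣ , φ

  isSurjection : ∀ {a b} {A : Set a} {B : Set b} → (A → B) → Set (a ⊔ b)
  isSurjection {A = A} f = ∀ y → ∥ Σ A (λ x → f x ≡ y) ∥

module Submission where

-- A partial element (P , φ) of X is determined by its convergence relation
-- x ↦ fibre φ x, and a delay d by x ↦ d ↓ x.  Weak bisimilarity is equality of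
-- convergence relations, so convergence descends to a proposition-valued
-- relation z ⇓ x on 𝓓 X / ≈ which determines z.  Hence E (P , w , φ) can be
-- defined as the unique class whose convergence relation is that of φ: being
-- unique, it may be constructed after choosing a Rosolini structure P ≡ ⟨ α ⟩,
-- and then δ n := φ n when α n = true is a delay with the right convergence.
-- The inverse sends z to the proposition Σ x, z ⇓ x with the first projection.

open import Defs
open import Level using (Level; _⊔_)
open import Function using (_∘_; id)
open import Data.Bool using (Bool; true; false)
open import Data.Bool.Properties using () renaming (_≟_ to _≟ᵇ_)
open import Data.Nat using (ℕ)
open import Data.Product using (Σ; _×_; _,_; proj₁; proj₂)
open import Data.Sum using (_⊎_; inj₁; inj₂)
open import Data.Sum.Properties using (inj₁-injective; inj₂-injective)
open import Data.Unit using (⊤; tt)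
open import Relation.Binary.PropositionalEquality
  using (_≡_; refl; sym; trans; cong; cong₂; subst)
open import Axiom.UniquenessOfIdentityProofs
  using (module Constant⇒UIP; module Decidable⇒UIP)

private
  variable
    a b c : Level
    A : Set a
    B : Set b
    C : Set c

infix 3 _⇔_

_⇔_ : Set a → Set b → Set (a ⊔ b)
A ⇔ B = (A → B) × (B → A)

⇔-sym : A ⇔ B → B ⇔ A
⇔-sym (f , g) = g , f

⇔-trans : A ⇔ B → B ⇔ C → A ⇔ C
⇔-trans (f , g) (f′ , g′) = f′ ∘ f , g ∘ g′

≡⇒⇔ : {A B : Set a} → A ≡ B → A ⇔ B
≡⇒⇔ refl = id , id

fibre : {P : Set a} {A : Set b} → (P → A) → A → Set (a ⊔ b)
fibre {P = P} φ x = Σ P λ p → φ p ≡ x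

_Represents_ : {P : Set a} {A : Set b} → (A → Set c) → (P → A) → Set (a ⊔ b ⊔ c)
_Represents_ {A = A} conv φ = (x : A) → conv x ⇔ fibre φ x

isProp⇒isSet : isProp A → isSet A
isProp⇒isSet h x y = Constant⇒UIP.≡-irrelevant (λ {u} {v} _ → h u v) (λ _ _ → refl)

Σ-≡-prop : {B : A → Set b} → (∀ x → isProp (B x))
         → {u v : Σ A B} → proj₁ u ≡ proj₁ v → u ≡ v
Σ-≡-prop h {x , _} {.x , _} refl = cong (x ,_) (h x _ _)

⊤-isSet : isSet ⊤
⊤-isSet = isProp⇒isSet λ _ _ → refl

≡true-isProp : {β : Bool} → isProp (β ≡ true)
≡true-isProp = Decidable⇒UIP.≡-irrelevant _≟ᵇ_

⊎-isSet : isSet A → isSet B → isSet (A ⊎ B)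
⊎-isSet {A = A} {B = B} setA setB _ _ =
  Constant⇒UIP.≡-irrelevant normalise normalise-constant
  where
  normalise : {u v : A ⊎ B} → u ≡ v → u ≡ v
  normalise {inj₁ _} {inj₁ _} p = cong inj₁ (inj₁-injective p)
  normalise {inj₂ _} {inj₂ _} p = cong inj₂ (inj₂-injective p)

  normalise-constant : {u v : A ⊎ B} (p q : u ≡ v) → normalise p ≡ normalise q
  normalise-constant {inj₁ x} {inj₁ y} p q = cong (cong inj₁) (setA x y _ _)
  normalise-constant {inj₂ x} {inj₂ y} p q = cong (cong inj₂) (setB x y _ _)

fibre-isProp : {P : Set a} {φ : P → A} {x : A}
             → isProp P → isSet A → isProp (fibre φ x)
fibre-isProp propP setA (p , _) (p′ , _) = Σ-≡-prop (λ _ → setA _ _) (propP p p′)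

module _ (fe : FunExt) where

  Π-isProp : {B : A → Set b} → (∀ x → isProp (B x)) → isProp ((x : A) → B x)
  Π-isProp h f g = fe λ x → h x (f x) (g x)

  ⇔-isProp : isProp A → isProp B → isProp (A ⇔ B)
  ⇔-isProp propA propB (f , g) (f′ , g′) =
    cong₂ _,_ (Π-isProp (λ _ → propB) f f′) (Π-isProp (λ _ → propA) g g′)

  isProp-isProp : isProp (isProp A)
  isProp-isProp i = Π-isProp (λ x → Π-isProp λ y → isProp⇒isSet i x y) i

hProp : Set₁
hProp = Σ Set isProp

module _ (fe : FunExt) (pe : PropExt) where

  hProp-ext : {P Q : hProp} → proj₁ P ⇔ proj₁ Q → P ≡ Q
  hProp-ext {P , i} {Q , j} (f , g) with pe P Q i j f g
  ... | refl = cong (P ,_) (isProp-isProp fe i j)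

  hProp-isSet : isSet hProp
  hProp-isSet _ _ = Constant⇒UIP.≡-irrelevant
    (λ p → hProp-ext (≡⇒⇔ (cong proj₁ p)))
    (λ {P} {Q} p q → cong hProp-ext (⇔-isProp fe (proj₂ P) (proj₂ Q) _ _))

rosoliniStructure⇒isProp : {P : Set} → rosoliniStructure P → isProp P
rosoliniStructure⇒isProp ((_ , propα) , refl) = propα

module _ (pt : PropTrunc) where
  open PropTrunc pt
  open WithPT pt

  isRosolini⇒isProp : FunExt → {P : Set} → isRosolini P → isProp P
  isRosolini⇒isProp fe = ∥∥-rec (isProp-isProp fe) rosoliniStructure⇒isProp

  q-isSurjection : {X : Set} → isSurjection (q {X})
  q-isSurjection (P , w , φ) =
    ∥∥-rec ∥∥-isProp (λ s → ∣ (P , s , φ) , cong (λ w′ → P , w′ , φ) (∥∥-isProp _ _) ∣) w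

isInl : A ⊎ B → Bool
isInl (inj₁ _) = true
isInl (inj₂ _) = false

isInl⇒inj₁ : (v : A ⊎ B) → isInl v ≡ true → Σ A λ x → v ≡ inj₁ x
isInl⇒inj₁ (inj₁ x) _ = x , refl

fromTrue : (β : Bool) → (β ≡ true → A) → A ⊎ ⊤
fromTrue true f = inj₁ (f refl)
fromTrue false f = inj₂ tt

fromTrue-inj₁ : {β : Bool} {f : β ≡ true → A} {x : A}
              → fromTrue β f ≡ inj₁ x → Σ (β ≡ true) λ t → f t ≡ x
fromTrue-inj₁ {β = true} p = refl , inj₁-injective p

fromTrue-true : {β : Bool} {f : β ≡ true → A} (t : β ≡ true) → fromTrue β f ≡ inj₁ (f t)
fromTrue-true refl = refl

module Delay (X : Set) (setX : isSet X) where

  X⊤-isSet : isSet (X ⊎ ⊤)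
  X⊤-isSet = ⊎-isSet setX ⊤-isSet

  ↓-isProp : (d : 𝓓 X) (x : X) → isProp (d ↓ x)
  ↓-isProp (δ , propδ) x (m , p) (n , q) =
    Σ-≡-prop (λ _ → X⊤-isSet _ _) (cong proj₁ (propδ (m , x , p) (n , x , q)))

  inj₁-preimage-isProp : (v : X ⊎ ⊤) → isProp (Σ X λ x → v ≡ inj₁ x)
  inj₁-preimage-isProp v (x , p) (y , q) =
    Σ-≡-prop (λ _ → X⊤-isSet _ _) (inj₁-injective (trans (sym p) q))

  Defined-isProp : {δ : ℕ → X ⊎ ⊤}
                 → (∀ {m n x y} → δ m ≡ inj₁ x → δ n ≡ inj₁ y → m ≡ n)
                 → isProp (Defined δ)
  Defined-isProp {δ} sameIndex (m , x , p) (n , y , q) =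
    Σ-≡-prop (λ k → inj₁-preimage-isProp (δ k)) (sameIndex p q)

  converges-isProp : (d : 𝓓 X) → isProp (Σ X (d ↓_))
  converges-isProp (_ , propδ) (x , m , p) (y , n , q) =
    cong (λ { (k , z , r) → z , k , r }) (propδ (m , x , p) (n , y , q))

  converges-rosolini : PropExt → (d : 𝓓 X) → rosoliniStructure (Σ X (d ↓_))
  converges-rosolini pe d@(δ , _) =
    (isInl ∘ δ , propα) , pe _ _ (converges-isProp d) propα to from
    where
    from : ⟨ isInl ∘ δ ⟩ → Σ X (d ↓_)
    from (n , t) = let x , p = isInl⇒inj₁ (δ n) t in x , n , p

    propα : isProp ⟨ isInl ∘ δ ⟩
    propα s t = Σ-≡-prop (λ _ → ≡true-isProp)
      (cong (proj₁ ∘ proj₂) (converges-isProp d (from s) (from t)))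

    to : Σ X (d ↓_) → ⟨ isInl ∘ δ ⟩
    to (_ , n , p) = n , cong isInl p

  module _ {α : ℕ → Bool} (propα : isProp ⟨ α ⟩) (φ : ⟨ α ⟩ → X) where

    partialSeq : ℕ → X ⊎ ⊤
    partialSeq n = fromTrue (α n) λ t → φ (n , t)

    partialSeq-represents : (partialSeq ↓-seq_) Represents φ
    partialSeq-represents x =
      (λ (n , p) → let t , φt≡x = fromTrue-inj₁ p in (n , t) , φt≡x) ,
      (λ ((n , t) , φt≡x) → n , trans (fromTrue-true t) (cong inj₁ φt≡x))

    partialDelay : 𝓓 X
    partialDelay = partialSeq , Defined-isProp λ p q →
      cong proj₁ (propα (_ , proj₁ (fromTrue-inj₁ p)) (_ , proj₁ (fromTrue-inj₁ q)))

  delayRepresenting : {P : Set} → rosoliniStructure P → (φ : P → X)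
                    → Σ (𝓓 X) λ d → (d ↓_) Represents φ
  delayRepresenting ((_ , propα) , refl) φ =
    partialDelay propα φ , partialSeq-represents propα φ

  v-represents : (δ : 𝓓 X) → (δ ↓_) Represents v[ δ ]
  v-represents δ x = (λ (n , p) → (n , x , p) , refl) , λ { ((n , _ , p) , refl) → n , p }

module Quotient (fe : FunExt) (pe : PropExt) (pt : PropTrunc) (sq : SetQuot)
                (X : Set) (setX : isSet X) where
  open PropTrunc pt
  open SetQuot sq
  open WithPT pt
  open Delay X setX

  𝓓/≈ : Set
  𝓓/≈ = 𝓓 X / _≈_

  -- Defined by recursion into hProp so that ⇓-[] holds without effectiveness of the quotient.
  ⇓-hProp : 𝓓/≈ → X → hProp
  ⇓-hProp z x = /-rec (hProp-isSet fe pe) (λ d → d ↓ x , ↓-isProp d x)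
                      (λ d e d≈e → hProp-ext fe pe (d≈e x)) z

  infix 20 _⇓_

  _⇓_ : 𝓓/≈ → X → Set
  z ⇓ x = proj₁ (⇓-hProp z x)

  ⇓-isProp : (z : 𝓓/≈) (x : X) → isProp (z ⇓ x)
  ⇓-isProp z x = proj₂ (⇓-hProp z x)

  ⇓-[] : {d : 𝓓 X} {x : X} → [ d ] ⇓ x ≡ d ↓ x
  ⇓-[] {d} = cong proj₁ (/-rec-β _ _ _ d)

  ⇓-ext : (z z′ : 𝓓/≈) → (∀ x → z ⇓ x ⇔ z′ ⇓ x) → z ≡ z′
  ⇓-ext = /-ind-prop (λ z → Π-isProp fe λ z′ → Π-isProp fe λ _ → /-isSet z z′) λ d →
          /-ind-prop (λ z′ → Π-isProp fe λ _ → /-isSet [ d ] z′) λ e [d]⇔[e] →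
          /-identify λ x → ⇔-trans (≡⇒⇔ (sym ⇓-[])) (⇔-trans ([d]⇔[e] x) (≡⇒⇔ ⇓-[]))

  represents-unique : {P : Set} {φ : P → X} {z z′ : 𝓓/≈}
                    → (z ⇓_) Represents φ → (z′ ⇓_) Represents φ → z ≡ z′
  represents-unique r r′ = ⇓-ext _ _ λ x → ⇔-trans (r x) (⇔-sym (r′ x))

  []-represents : {P : Set} {φ : P → X} {d : 𝓓 X}
                → (d ↓_) Represents φ → ([ d ] ⇓_) Represents φ
  []-represents r x = ⇔-trans (≡⇒⇔ ⇓-[]) (r x)

  Representative : {P : Set} → (P → X) → Set
  Representative φ = Σ 𝓓/≈ λ z → (z ⇓_) Represents φ

  Representative-isProp : {P : Set} {φ : P → X} → isProp P → isProp (Representative φ)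
  Representative-isProp propP (z , r) (z′ , r′) = Σ-≡-prop
    (λ z → Π-isProp fe λ x → ⇔-isProp fe (⇓-isProp z x) (fibre-isProp propP setX))
    (represents-unique r r′)

  representative : {P : Set} → isRosolini P → (φ : P → X) → Representative φ
  representative w φ = ∥∥-rec (Representative-isProp (isRosolini⇒isProp pt fe w))
    (λ s → let d , r = delayRepresenting s φ in [ d ] , []-represents r) w

  E : 𝓛-isRosolini X → 𝓓/≈
  E (_ , w , φ) = proj₁ (representative w φ)

  E-represents : (l : 𝓛-isRosolini X) → (E l ⇓_) Represents proj₂ (proj₂ l)
  E-represents (_ , w , φ) = proj₂ (representative w φ)

  E-≡ : {P : Set} {w : isRosolini P} {φ : P → X} {z : 𝓓/≈}
      → (z ⇓_) Represents φ → E (P , w , φ) ≡ z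
  E-≡ = represents-unique (E-represents _)

  ⇓-isRosolini : (z : 𝓓/≈) → isRosolini (Σ X (z ⇓_))
  ⇓-isRosolini = /-ind-prop (λ _ → ∥∥-isProp) λ d →
    ∣ subst rosoliniStructure (cong (Σ X) (fe λ _ → sym ⇓-[])) (converges-rosolini pe d) ∣

  E⁻¹ : 𝓓/≈ → 𝓛-isRosolini X
  E⁻¹ z = Σ X (z ⇓_) , ⇓-isRosolini z , proj₁

  proj₁-represents : {z : 𝓓/≈} → (z ⇓_) Represents (proj₁ {B = z ⇓_})
  proj₁-represents x = (λ t → (x , t) , refl) , λ { ((_ , t) , refl) → t }

  𝓛-≡ : {A B : Set} {w : isRosolini A} {w′ : isRosolini B} {f : A → X} {g : B → X}
      → A ≡ B → (h : A → B) → isProp B → (∀ a → f a ≡ g (h a))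
      → _≡_ {A = 𝓛-isRosolini X} (A , w , f) (B , w′ , g)
  𝓛-≡ {g = g} refl h propB agree =
    cong₂ (λ w f → _ , w , f) (∥∥-isProp _ _) (fe λ a → trans (agree a) (cong g (propB _ _)))

  E⁻¹-≡ : {P : Set} {w : isRosolini P} {φ : P → X} {z : 𝓓/≈}
        → (z ⇓_) Represents φ → E⁻¹ z ≡ (P , w , φ)
  E⁻¹-≡ {P} {w} {φ} {z} r =
    𝓛-≡ (pe _ _ (isRosolini⇒isProp pt fe (⇓-isRosolini z)) propP to from) to propP
        (λ (x , t) → sym (proj₂ (proj₁ (r x) t)))
    where
    propP : isProp P
    propP = isRosolini⇒isProp pt fe w

    to : Σ X (z ⇓_) → P
    to (x , t) = proj₁ (proj₁ (r x) t)

    from : P → Σ X (z ⇓_)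
    from p = φ p , proj₂ (r (φ p)) (p , refl)

  E-isEquiv : isEquiv E
  E-isEquiv = (E⁻¹ , λ l → E⁻¹-≡ (E-represents l)) , (E⁻¹ , λ z → E-≡ proj₁-represents)

  E-[] : (δ : 𝓓 X) (w : isRosolini P[ δ ]) → E (P[ δ ] , w , v[ δ ]) ≡ [ δ ]
  E-[] δ w = E-≡ ([]-represents (v-represents δ))

theorem5p28 : FunExt → PropExt → (pt : PropTrunc) → (sq : SetQuot)
    → let open SetQuot sq in let open WithPT pt in
      (X : Set)
    → isSurjection (q {X})
      × (isSet X
         → Σ (𝓛-isRosolini X → 𝓓 X / _≈_) λ E
             → isEquiv E
               × ((δ : 𝓓 X) (w : isRosolini P[ δ ]) → E (P[ δ ] , w , v[ δ ]) ≡ [ δ ]))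
theorem5p28 fe pe pt sq X = q-isSurjection pt , λ setX →
  let open Quotient fe pe pt sq X setX in E , E-isEquiv , E-[]
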